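{- Let $M$ be a reachable clean marking of a t-net. Then $M$ has a unique pid-tree representation, i.e. $\mathit{repr}(M)$ has exactly one element.
   Context: Process identifiers (pids). $\mathbb{P}=(\mathbb{N}^+)^*$ is the set of finite tuples of positive integers, including $\langle\rangle$, under concatenation; $\langle a_1,\dots,a_n\rangle$ is written $a_1.\cdots.a_n$. For $\pi=\langle a_1,\dots,a_n\rangle$: $\mathit{prefix}(\pi)=\langle a_1,\dots,a_{n-1}\rangle$ if $n>0$, else $\langle\rangle$; $\mathit{subpid}(\pi)=\{\pi\}\cup\mathit{subpid}(\mathit{prefix}(\pi))$ if $n>0$, $\emptyset$ if $n=0$. $\mathbb P$ is ordered hierarchically: by length, then lexicographically. Coloured Petri nets and t-nets. Fix data values $\mathbb D\supseteq\mathbb N$ (disjoint from $\mathbb P$), variables $\mathbb V$, expressions $\mathbb E\supseteq\mathbb V\cup\mathbb D$; bindings are partial maps $\beta:\mathbb V\to\mathbb P\cup\mathbb D$ extended to expressions. A Petri net $(S,T,\ell)$ has finite disjoint places and transitions, place types $\ell(s)=X_1\times\dots\times X_k$ ($X_i\in\{\mathbb P,\mathbb D\}$), guards $\ell(t)\in\mathbb E$, arc labels $\ell(x,y)$ multisets over $\mathbb E$. A marking maps places to multisets of tokens of their type; $M\xrightarrow{t,\beta}M'$ iff $M(s)\ge\beta(\ell(s,t))$, $\beta(\ell(t,s))$ has type $\ell(s)$, $M'(s)=M(s)-\beta(\ell(s,t))+\beta(\ell(t,s))$ for all $s$, and $\beta(\ell(t))$ holds. A t-net additionally has: a unique generator place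 $s_\eta$ of type $\mathbb P\times\mathbb N$; initial marking with $M_0(s_\eta)=\{\langle\langle1\rangle,0\rangle\}$, other places empty or containing only data; for each $t$, $\ell(s_\eta,t)=\{\langle p_i,c_i\rangle:1\le i\le k\}$ (distinct variables) and $\ell(t,s_\eta)=\{\langle p_i,c_i+n_i\rangle:1\le i\le m\}\cup\{\langle p_i.(c_i+j),0\rangle:1\le i\le k,1\le j\le n_i\}$ ($m\le k$, $n_i\ge0$), $\Pi_t$ being the set of the $p_i.(c_i+j)$; arcs from $s\ne s_\eta$ carry vectors of variables and data values; arcs to $s\ne s_\eta$ carry vectors of expressions over data variables/values and elements of $\Pi_t\cup\{p_1,\dots,p_m\}$; guards are computable Boolean expressions in which pids are only compared by equality, parent, ancestor and younger-sibling relations. Reachable markings are reached from $M_0$ by finitely many firings. States. For reachable $M$: $\eta_M=\{\pi\mapsto k:\langle\pi,k\rangle\in M(s_\eta)\}$; $\mathit{nextpid}_M=\{\pi.(\eta_M(\pi)+1):\pi\in\mathrm{dom}(\eta_M)\}$; $\mathit{pid}_M$ is the set of pids occurring in tokens of $M$ in any place (including $s_\eta$) — the active pids. $M$ is clean if for every $\pi\in\mathit{pid}_M\cup\mathit{nextpid}_M$ with $\pi\ne\langle1\rangle$, its parent $\mathit{prefix}(\pi)$ is active, i.e. belongs to $\mathit{pid}_M$. Pid-trees. $\Xi$ is the least set with $\langle M,C\rangle\in\Xi$ for a marking $M$ and $C=\langle\langle a_1,t_1\rangle,\dots,\langle a_n,t_n\rangle\rangle$, $t_i\in\Xi$, $a_i\in\mathbb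 P\setminus\{\langle\rangle\}$, for $i\ne j$: $a_i\ne a_j$, $a_i\notin\mathit{subpid}(a_j)$, $a_j\notin\mathit{subpid}(a_i)$; written $M\xrightarrow{a_1,\dots,a_n}\langle t_1,\dots,t_n\rangle$. Inclusion: $\langle M',\langle\langle a'_i,t'_i\rangle\rangle_{i\le m}\rangle\subseteq\langle M,\langle\langle a_j,t_j\rangle\rangle_{j\le n}\rangle$ iff $M'\le M$ and each $i$ has $j$ with $a'_i=a_j$, $t'_i\subseteq t_j$. Subtrees: $\langle\langle\rangle,t_0\rangle\in\mathit{Trees}(t_0)$ and $\langle a_i.\pi',t\rangle\in\mathit{Trees}(t_0)$ if $\langle\pi',t\rangle\in\mathit{Trees}(t_i)$; $\mathit{pid}(t)=\{\pi:\langle\pi,t'\rangle\in\mathit{Trees}(t)\}$. Path labelled $\pi$ decorated by $M'$: pid-tree $t$ with $\pi\in\mathit{pid}(t)\subseteq\mathit{subpid}(\pi)\cup\{\langle\rangle\}$, $\langle\pi,\langle M',\langle\rangle\rangle\rangle\in\mathit{Trees}(t)$, all other markings empty; "$R$ contains $\mathit{path}(\pi,M')$" means such a path is $\subseteq R$; $\mathit{path}(\pi)=\mathit{path}(\pi,\emptyset)$. Sibling ordered: $a_1\le\dots\le a_n$ (hierarchically) at every node. Representations. $\mathit{repr}(M)$: sibling ordered pid-trees $R$ built so that for each place $s$ of type $X_1\times\dots\times X_n$ and token $v=\langle x_1,\dots,x_n\rangle\in M(s)$ exactly one rule applies, and $R$ contains nothing beyond what the rules require (tokens with multiplicity): generator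 rule ($s=s_\eta$, $v=\langle\pi,i\rangle$): $R$ contains $\mathit{path}(\pi)$ and $\mathit{path}(\pi.(i+1))$; shared rule ($X_1=\mathbb D$): $R$ contains $\mathit{path}(\langle\rangle,\{(s,v)\})$ and $\mathit{path}(x_i)$ for every $X_i=\mathbb P$; owned rule ($X_1=\mathbb P$): $R$ contains $\mathit{path}(x_1,\{(s,v)\})$ and $\mathit{path}(x_i)$ for every $X_i=\mathbb P$. -}

module Defs where

open import Data.Nat using (ℕ; zero; suc; _+_; _≤_; _<_; _<ᵇ_; NonZero)
open import Data.Nat.Properties using () renaming (_≟_ to _≟ℕ_)
open import Data.Bool using (Bool; true; false; _∧_; _∨_; not; T)
open import Data.Fin using (Fin; inject≤)
open import Data.List using (List; []; _∷_; _++_; map; concatMap; concat; length; _∷ʳ_; last; allFin)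
import Data.List.NonEmpty as List⁺
open import Data.List.NonEmpty using (List⁺)
open import Data.List.Properties using (≡-dec)
open import Data.List.Relation.Unary.All using (All)
open import Data.List.Relation.Unary.Any using (Any)
open import Data.List.Relation.Unary.AllPairs using (AllPairs)
open import Data.List.Relation.Unary.Linked using (Linked)
open import Data.List.Relation.Binary.Pointwise using (Pointwise)
open import Data.List.Membership.Propositional using (_∈_)
open import Data.List.Relation.Binary.Permutation.Propositional using (_↭_)
open import Data.Maybe using (Maybe; just; nothing; _>>=_)
open import Data.Product using (Σ; ∃; ∃₂; _×_; _,_; proj₁; proj₂)
open import Data.Sum using (_⊎_; inj₁; inj₂; [_,_])
open import Relation.Binary.PropositionalEquality using (_≡_; _≢_)
open import Relation.Binary.Construct.Closure.ReflexiveTransitive using (Star)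
open import Relation.Nullary using (¬_; does)
open import Function.Definitions using (Injective)

-- Process identifiers: finite tuples of (positive) naturals.

Pid : Set
Pid = List ℕ

_≟ₚ_ : (a b : Pid) → _
_≟ₚ_ = ≡-dec _≟ℕ_

prefix : Pid → Pid
prefix []           = []
prefix (x ∷ [])     = []
prefix (x ∷ y ∷ xs) = x ∷ prefix (y ∷ xs)

data _∈subpid_ : Pid → Pid → Set where
  here  : ∀ {π} → π ≢ [] → π ∈subpid π
  there : ∀ {x π} → π ≢ [] → x ∈subpid prefix π → x ∈subpid π

data _≤lex_ : Pid → Pid → Set where
  []≤  : ∀ {ys} → [] ≤lex ys
  <∷   : ∀ {x y xs ys} → x < y → (x ∷ xs) ≤lex (y ∷ ys)
  ≡∷   : ∀ {x xs ys} → xs ≤lex ys → (x ∷ xs) ≤lex (x ∷ ys)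

_≤ₕ_ : Pid → Pid → Set
a ≤ₕ b = (length a < length b) ⊎ ((length a ≡ length b) × (a ≤lex b))

-- Boolean pid relations usable in guards
eqᵇ : Pid → Pid → Bool
eqᵇ a b = does (a ≟ₚ b)

nonEmptyᵇ : Pid → Bool
nonEmptyᵇ [] = false
nonEmptyᵇ (_ ∷ _) = true

isPrefixᵇ : Pid → Pid → Bool
isPrefixᵇ []       _        = true
isPrefixᵇ (x ∷ xs) []       = false
isPrefixᵇ (x ∷ xs) (y ∷ ys) = does (x ≟ℕ y) ∧ isPrefixᵇ xs ys

parentᵇ : Pid → Pid → Bool
parentᵇ a b = nonEmptyᵇ b ∧ eqᵇ a (prefix b)

ancestorᵇ : Pid → Pid → Bool
ancestorᵇ a b = nonEmptyᵇ a ∧ isPrefixᵇ a b ∧ (length a <ᵇ length b)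

-- a is a younger sibling of b (same parent, created later)
ysiblingᵇ : Pid → Pid → Bool
ysiblingᵇ a b with last a | last b
... | just x | just y = eqᵇ (prefix a) (prefix b) ∧ (y <ᵇ x)
... | _      | _      = false

-- The ambient language: data values 𝔻 = ℕ ⊎ D₀ (so 𝔻 ⊇ ℕ), variables,
-- data expressions and data guards with computable evaluation.

record Lang : Set₁ where
  field
    D₀     : Set
    Var    : Set
    DExpr  : Set
    DGuard : Set
    evalE  : DExpr → (Var → Maybe (ℕ ⊎ D₀)) → Maybe (ℕ ⊎ D₀)
    evalG  : DGuard → (Var → Maybe (ℕ ⊎ D₀)) → Bool

data Ty : Set where
  ℙty 𝔻ty : Ty

data Place (nS : ℕ) : Set where
  sη : Place nS
  pl : Fin nS → Place nS

module _ (L : Lang) where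
  open Lang L

  Dat : Set
  Dat = ℕ ⊎ D₀

  data Val : Set where
    pidv : Pid → Val
    datv : Dat → Val

  num : ℕ → Val
  num n = datv (inj₁ n)

  HasTy : Ty → Val → Set
  HasTy ℙty v = ∃ λ π → v ≡ pidv π
  HasTy 𝔻ty v = ∃ λ d → v ≡ datv d

  -- markings: finite multisets of (place, token), as lists up to permutation
  Marking : ℕ → Set
  Marking nS = List (Place nS × List Val)

  _≤ₘ_ : ∀ {nS} → Marking nS → Marking nS → Set
  M' ≤ₘ M = ∃ λ R → M ↭ (M' ++ R)

  data Guard : Set where
    gData : DGuard → Guard
    gEq gParent gAncestor gYSibling : Var → Var → Guard
    gTrue : Guard
    gNot  : Guard → Guard
    gAnd gOr : Guard → Guard → Guard

  data OutE (k m : ℕ) (n : Fin k → ℕ) : Set where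
    oData   : DExpr → OutE k m n
    oChild  : (i : Fin k) → Fin (n i) → OutE k m n   -- p_i.(c_i + (j+1))
    oParent : Fin m → OutE k m n                     -- p_i, i ≤ m

  record Transition (nS : ℕ) : Set where
    field
      k m   : ℕ
      m≤k   : m ≤ k
      pv cv : Fin k → Var
      distinct : Injective _≡_ _≡_ [ pv , cv ]
      n     : Fin k → ℕ
      guard : Guard
      inArc  : Fin nS → List (List (Var ⊎ Dat))
      outArc : Fin nS → List (List (OutE k m n))

  record TNet : Set₁ where
    field
      nS nT : ℕ
      ty    : Fin nS → List⁺ Ty
      trans : Fin nT → Transition nS
      init  : List (Fin nS × List Dat)

  Binding : Set
  Binding = Var → Maybe Val

  datOnly : Binding → Var → Maybe Dat
  datOnly β x with β x
  ... | just (datv d) = just d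
  ... | _             = nothing

  seqM : {A : Set} → List (Maybe A) → Maybe (List A)
  seqM [] = just []
  seqM (x ∷ xs) = x >>= λ a → seqM xs >>= λ as → just (a ∷ as)

  pidRel : (Pid → Pid → Bool) → Maybe Val → Maybe Val → Bool
  pidRel r (just (pidv a)) (just (pidv b)) = r a b
  pidRel r _ _ = false

  evalGuard : Binding → Guard → Bool
  evalGuard β (gData g) = evalG g (datOnly β)
  evalGuard β (gEq x y) = pidRel eqᵇ (β x) (β y)
  evalGuard β (gParent x y) = pidRel parentᵇ (β x) (β y)
  evalGuard β (gAncestor x y) = pidRel ancestorᵇ (β x) (β y)
  evalGuard β (gYSibling x y) = pidRel ysiblingᵇ (β x) (β y)
  evalGuard β gTrue = true
  evalGuard β (gNot g) = not (evalGuard β g)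
  evalGuard β (gAnd g h) = evalGuard β g ∧ evalGuard β h
  evalGuard β (gOr g h) = evalGuard β g ∨ evalGuard β h

  asPid : Maybe Val → Maybe Pid
  asPid (just (pidv π)) = just π
  asPid _ = nothing

  asNat : Maybe Val → Maybe ℕ
  asNat (just (datv (inj₁ c))) = just c
  asNat _ = nothing

  module _ {nS : ℕ} (t : Transition nS) (β : Binding) where
    open Transition t

    evalIn1 : Var ⊎ Dat → Maybe Val
    evalIn1 (inj₁ x) = β x
    evalIn1 (inj₂ d) = just (datv d)

    childPid : Fin k → ℕ → Maybe Val
    childPid i j = asPid (β (pv i)) >>= λ π → asNat (β (cv i)) >>= λ c → just (pidv (π ∷ʳ (c + j)))

    evalOut1 : OutE k m n → Maybe Val
    evalOut1 (oData e) = evalE e (datOnly β) >>= λ d → just (datv d)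
    evalOut1 (oChild i j) = childPid i (suc (Data.Fin.toℕ j))
    evalOut1 (oParent i) = β (pv (inject≤ i m≤k))

    preM : Maybe (Marking nS)
    preM = seqM (map (λ i → seqM (β (pv i) ∷ β (cv i) ∷ []) >>= λ v → just (sη , v)) (allFin k)
             ++ concatMap (λ s → map (λ vec → seqM (map evalIn1 vec) >>= λ v → just (pl s , v)) (inArc s)) (allFin nS))

    postM : Maybe (Marking nS)
    postM = seqM (map (λ i → β (pv (inject≤ i m≤k)) >>= λ p →
                             asNat (β (cv (inject≤ i m≤k))) >>= λ c →
                             just (sη , (p ∷ num (c + n (inject≤ i m≤k)) ∷ []))) (allFin m)
             ++ concatMap (λ i → map (λ j → childPid i (suc (Data.Fin.toℕ j)) >>= λ p → just (sη , (p ∷ num 0 ∷ [])))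
                                     (allFin (n i))) (allFin k)
             ++ concatMap (λ s → map (λ vec → seqM (map evalOut1 vec) >>= λ v → just (pl s , v)) (outArc s)) (allFin nS))

  module _ (N : TNet) where
    open TNet N

    Typed : Place nS → List Val → Set
    Typed sη v = ∃₂ λ π c → v ≡ (pidv π ∷ num c ∷ [])
    Typed (pl s) v = Pointwise HasTy (List⁺.toList (ty s)) v

    M₀ : Marking nS
    M₀ = (sη , (pidv (1 ∷ []) ∷ num 0 ∷ [])) ∷ map (λ sv → pl (proj₁ sv) , map datv (proj₂ sv)) init

    Fires : Marking nS → Fin nT → Binding → Marking nS → Set
    Fires M t β M' = ∃₂ λ pre post →
        (preM (trans t) β ≡ just pre) × (postM (trans t) β ≡ just post)
      × All (λ sv → Typed (proj₁ sv) (proj₂ sv)) post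
      × T (evalGuard β (Transition.guard (trans t)))
      × ∃ λ R → (M ↭ (pre ++ R)) × (M' ↭ (R ++ post))

    Step : Marking nS → Marking nS → Set
    Step M M' = ∃₂ λ t β → Fires M t β M'

    WellFormedNet : Set
    WellFormedNet = All (λ sv → Typed (pl (proj₁ sv)) (map datv (proj₂ sv))) init

    Reachable : Marking nS → Set
    Reachable M = Star Step M₀ M

  module _ {nS : ℕ} where

    ActivePid : Pid → Marking nS → Set
    ActivePid π M = Any (λ sv → pidv π ∈ proj₂ sv) M

    NextPid : Pid → Marking nS → Set
    NextPid π' M = ∃₂ λ π i → ((sη , (pidv π ∷ num i ∷ [])) ∈ M) × (π' ≡ π ∷ʳ suc i)

    Clean : Marking nS → Set
    Clean M = ∀ π → (ActivePid π M ⊎ NextPid π M) → π ≢ (1 ∷ []) → ActivePid (prefix π) M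

    data Tree : Set where
      node : Marking nS → List (Pid × Tree) → Tree

    markingOf : Tree → Marking nS
    markingOf (node M _) = M

    Apart : Pid → Pid → Set
    Apart a b = (a ≢ b) × (¬ (a ∈subpid b)) × (¬ (b ∈subpid a))

    data PidTree : Tree → Set where
      node : ∀ {M C} → All (λ c → (proj₁ c ≢ []) × All NonZero (proj₁ c)) C
           → AllPairs Apart (map proj₁ C)
           → All (λ c → PidTree (proj₂ c)) C
           → PidTree (node M C)

    data _⊆ₜ_ : Tree → Tree → Set where
      incl : ∀ {M' M C' C} → M' ≤ₘ M
           → All (λ c' → Any (λ c → (proj₁ c' ≡ proj₁ c) × (proj₂ c' ⊆ₜ proj₂ c)) C) C'
           → node M' C' ⊆ₜ node M C

    data InTrees : Pid → Tree → Tree → Set where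
      root  : ∀ {t} → InTrees [] t t
      child : ∀ {a ti π t M C} → (a , ti) ∈ C → InTrees π t ti → InTrees (a ++ π) t (node M C)

    _∈pid_ : Pid → Tree → Set
    π ∈pid t = ∃ λ t' → InTrees π t' t

    data SiblingOrdered : Tree → Set where
      node : ∀ {M C} → Linked _≤ₕ_ (map proj₁ C) → All (λ c → SiblingOrdered (proj₂ c)) C
           → SiblingOrdered (node M C)

    IsPath : Pid → Marking nS → Tree → Set
    IsPath π M' t = PidTree t × (π ∈pid t)
                  × (∀ π' → π' ∈pid t → (π' ∈subpid π) ⊎ (π' ≡ []))
                  × InTrees π (node M' []) t
                  × (∀ π' t' → InTrees π' t' t → π' ≢ π → markingOf t' ≡ [])

    ContainsPath : Tree → Pid → Marking nS → Set
    ContainsPath R π M' = ∃ λ t → IsPath π M' t × (t ⊆ₜ R)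

  module _ (N : TNet) where
    open TNet N

    pidReqs : List Ty → List Val → List (Pid × Marking nS)
    pidReqs (ℙty ∷ tys) (pidv x ∷ vs) = (x , []) ∷ pidReqs tys vs
    pidReqs (_ ∷ tys) (_ ∷ vs) = pidReqs tys vs
    pidReqs _ _ = []

    ownerReq : Place nS → List Val → List (Pid × Marking nS)
    ownerReq s (pidv x ∷ vs) = (x , ((s , pidv x ∷ vs) ∷ [])) ∷ []
    ownerReq s _ = []

    reqTok : Place nS → List Val → List (Pid × Marking nS)
    reqTok sη (pidv π ∷ datv (inj₁ i) ∷ []) = (π , []) ∷ ((π ∷ʳ suc i) , []) ∷ []
    reqTok sη _ = []
    reqTok (pl s) v with List⁺.head (ty s)
    ... | 𝔻ty = ([] , ((pl s , v) ∷ [])) ∷ pidReqs (List⁺.toList (ty s)) v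
    ... | ℙty = ownerReq (pl s) v ++ pidReqs (List⁺.toList (ty s)) v

    reqs : Marking nS → List (Pid × Marking nS)
    reqs M = concatMap (λ sv → reqTok (proj₁ sv) (proj₂ sv)) M

    gather : Pid → List (Pid × Marking nS) → Marking nS
    gather π rs = concatMap (λ r → if' eqᵇ (proj₁ r) π then proj₂ r else []) rs
      where
        if'_then_else_ : Bool → Marking nS → Marking nS → Marking nS
        if' true then x else y = x
        if' false then x else y = y

    SatisfiesRules : Marking nS → Tree → Set
    SatisfiesRules M R = ∀ π → π ∈ map proj₁ (reqs M) → ContainsPath R π (gather π (reqs M))

    -- R ∈ repr(M): sibling ordered pid-tree satisfying the rules, containing nothing beyond
    -- what they require (minimal w.r.t. ⊆ among such trees)
    InRepr : Marking nS → Tree → Set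
    InRepr M R = PidTree R × SiblingOrdered R × SatisfiesRules M R
               × (∀ R' → PidTree R' → SiblingOrdered R' → SatisfiesRules M R' → R' ⊆ₜ R → R ⊆ₜ R')

    -- repr(M) has exactly one element (trees identified up to mutual inclusion,
    -- i.e. equality of node markings as multisets)
    UniqueRepr : Marking nS → Set
    UniqueRepr M = (∃ λ R → InRepr M R)
                 × (∀ R₁ R₂ → InRepr M R₁ → InRepr M R₂ → (R₁ ⊆ₜ R₂) × (R₂ ⊆ₜ R₁))

module Submission where

-- For a marking M let the requirements of M be the (pid, decoration) pairs that
-- the generator, shared and owned rules demand; a tree satisfies the rules iff it contains,
-- for every required pid π, the path to π decorated by everything demanded at π.  We build
-- one explicit candidate, the canonical tree R₀: the trie of all required pids, branching on
-- single components in increasing order, whose node at position σ carries exactly the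
-- decoration demanded at σ.  Two facts about reachable clean markings make R₀ work:
-- every pid occurring in a reachable marking has positive components (an invariant of
-- firing), and by cleanliness the required pids are closed under nonempty prefixes, so every
-- required pid is reached in R₀ along single-component edges.  R₀ is then a sibling ordered
-- pid-tree satisfying the rules, and it is the least such tree: the rigidity of pid-trees
-- (distinct children of a node have apart labels, so positions determine subtrees) lets us
-- embed R₀ into any pid-tree that satisfies the rules.  By minimality every element of
-- repr(M) is therefore inclusion-equivalent to R₀, which is proposition6.

open import Defs
open import Data.Nat using (ℕ; zero; suc; _+_; _≤_; _<_; NonZero; ≢-nonZero; s≤s)
open import Data.Nat.Properties using (≤-trans; m≤m+n; m≤n+m; n≤1+n; <-irrefl; m+1+n≢0)
open import Data.Nat.ListAction using (sum)
open import Data.Fin using (Fin; toℕ; inject≤)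
open import Data.Unit using (⊤; tt)
open import Data.Maybe using (Maybe; just; nothing; _>>=_)
open import Data.List using (List; []; _∷_; _++_; _∷ʳ_; map; length; upTo; filter; allFin)
import Data.List.NonEmpty as List⁺
open import Data.List.Properties
  using (++-assoc; ++-identityʳ; ++-identityʳ-unique; ++-conicalˡ; ++-conicalʳ; ∷-injective)
open import Data.List.Relation.Unary.All as All using (All; []; _∷_)
import Data.List.Relation.Unary.All.Properties as AllP
open import Data.List.Relation.Unary.Any as Any using (Any; here; there)
open import Data.List.Relation.Unary.AllPairs as AllPairs using (AllPairs; []; _∷_)
import Data.List.Relation.Unary.AllPairs.Properties as AllPairsP
open import Data.List.Relation.Unary.Linked using ([])
open import Data.List.Relation.Unary.Linked.Properties using (AllPairs⇒Linked)
open import Data.List.Relation.Binary.Pointwise using (Pointwise; _∷_)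
open import Data.List.Relation.Binary.Permutation.Propositional using (↭-sym; ↭-trans; ↭-refl; ↭-reflexive)
open import Data.List.Relation.Binary.Permutation.Propositional.Properties using (++⁺ʳ; All-resp-↭)
open import Data.List.Membership.Propositional using (_∈_; find; lose)
open import Data.List.Membership.Propositional.Properties
  using (∈-map⁺; ∈-map⁻; ∈-++⁺ˡ; ∈-++⁺ʳ; ∈-++⁻; ∈-concatMap⁺; ∈-concatMap⁻; ∈-filter⁺; ∈-upTo⁺;
         ∈-allFin)
open import Data.List.Membership.DecPropositional _≟ₚ_ using (_∈?_)
open import Relation.Binary.Construct.Closure.ReflexiveTransitive using (Star; ε; _◅_)
open import Data.Product using (∃; _×_; _,_; proj₁; proj₂)
open import Data.Product.Properties using (,-injective)
open import Data.Sum using (_⊎_; inj₁; inj₂)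
open import Data.Empty using (⊥-elim)
open import Relation.Nullary using (¬_; yes; no)
open import Relation.Binary.PropositionalEquality using (_≡_; _≢_; refl; sym; trans; cong; subst)

∷ʳ-nonempty : (x : Pid) (c : ℕ) → x ∷ʳ c ≢ []
∷ʳ-nonempty []      c ()
∷ʳ-nonempty (_ ∷ _) c ()

prefix-∷ʳ : (x : Pid) (c : ℕ) → prefix (x ∷ʳ c) ≡ x
prefix-∷ʳ []          c = refl
prefix-∷ʳ (a ∷ [])    c = refl
prefix-∷ʳ (a ∷ b ∷ x) c = cong (a ∷_) (prefix-∷ʳ (b ∷ x) c)

∈subpid-trans : {a b c : Pid} → a ∈subpid b → b ∈subpid c → a ∈subpid c
∈subpid-trans a∈b (here _)         = a∈b
∈subpid-trans a∈b (there c≢[] b∈c) = there c≢[] (∈subpid-trans a∈b b∈c)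

∈subpid-∷ʳ : (x : Pid) (c : ℕ) → x ≢ [] → x ∈subpid (x ∷ʳ c)
∈subpid-∷ʳ x c x≢[] = there (∷ʳ-nonempty x c) (subst (x ∈subpid_) (sym (prefix-∷ʳ x c)) (here x≢[]))

∈subpid-++ : (x z : Pid) → x ≢ [] → x ∈subpid (x ++ z)
∈subpid-++ x []      x≢[] = subst (x ∈subpid_) (sym (++-identityʳ x)) (here x≢[])
∈subpid-++ x (c ∷ z) x≢[] = subst (x ∈subpid_) (++-assoc x (c ∷ []) z)
  (∈subpid-trans (∈subpid-∷ʳ x c x≢[]) (∈subpid-++ (x ∷ʳ c) z (∷ʳ-nonempty x c)))

∈subpid-singleton : {x : Pid} {b : ℕ} → x ∈subpid (b ∷ []) → x ≡ b ∷ []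
∈subpid-singleton (here _)                  = refl
∈subpid-singleton (there _ (here []≢[]))    = ⊥-elim ([]≢[] refl)
∈subpid-singleton (there _ (there []≢[] _)) = ⊥-elim ([]≢[] refl)

++-split : {A : Set} (xs ys us vs : List A) → xs ++ ys ≡ us ++ vs
  → (∃ λ z → us ≡ xs ++ z × ys ≡ z ++ vs) ⊎ (∃ λ z → xs ≡ us ++ z × vs ≡ z ++ ys)
++-split []       ys us       vs eq = inj₁ (us , refl , eq)
++-split (x ∷ xs) ys []       vs eq = inj₂ (x ∷ xs , refl , sym eq)
++-split (x ∷ xs) ys (u ∷ us) vs eq with ∷-injective eq
... | refl , eq′ with ++-split xs ys us vs eq′
...   | inj₁ (z , e₁ , e₂) = inj₁ (z , cong (x ∷_) e₁ , e₂)
...   | inj₂ (z , e₁ , e₂) = inj₂ (z , cong (x ∷_) e₁ , e₂)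

∈⇒≤sum : {n : ℕ} {ns : List ℕ} → n ∈ ns → n ≤ sum ns
∈⇒≤sum {ns = n ∷ ns} (here refl) = m≤m+n n (sum ns)
∈⇒≤sum {ns = m ∷ ns} (there n∈)  = ≤-trans (∈⇒≤sum n∈) (m≤n+m (sum ns) m)

_⇒_ : {A : Set} → Maybe A → (A → Set) → Set
m ⇒ P = ∀ {y} → m ≡ just y → P y

>>=-⇒ : {A B : Set} (m : Maybe A) {P : B → Set} {f : A → Maybe B}
  → (∀ {x} → m ≡ just x → f x ⇒ P) → (m >>= f) ⇒ P
>>=-⇒ (just x) h eq = h refl eq
>>=-⇒ nothing  h ()

-- Tree inclusion, positions in trees, and the rigidity of pid-trees

module Trees (L : Lang) (nS : ℕ) where

  Mk : Set
  Mk = Marking L nS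

  Tr : Set
  Tr = Tree L {nS}

  _≤M_ : Mk → Mk → Set
  _≤M_ = _≤ₘ_ L

  _⊑_ : Tr → Tr → Set
  _⊑_ = _⊆ₜ_ L

  At : Pid → Tr → Tr → Set
  At = InTrees L

  IsPidTree : Tr → Set
  IsPidTree = PidTree L

  Match : Pid × Tr → Pid × Tr → Set
  Match c′ c = (proj₁ c′ ≡ proj₁ c) × (proj₂ c′ ⊑ proj₂ c)

  ≤M-refl : (m : Mk) → m ≤M m
  ≤M-refl m = [] , ↭-reflexive (sym (++-identityʳ m))

  []≤M : (m : Mk) → [] ≤M m
  []≤M m = m , ↭-refl

  ≤M-trans : {a b c : Mk} → a ≤M b → b ≤M c → a ≤M c
  ≤M-trans {a} (X , b↭aX) (Y , c↭bY) =
    X ++ Y , ↭-trans c↭bY (↭-trans (++⁺ʳ Y b↭aX) (↭-reflexive (++-assoc a X Y)))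

  mutual
    ⊑-trans : {t₁ t₂ t₃ : Tr} → t₁ ⊑ t₂ → t₂ ⊑ t₃ → t₁ ⊑ t₃
    ⊑-trans (incl p A) (incl q B) = incl (≤M-trans p q) (matches-trans A B)

    matches-trans : {C₁ C₂ C₃ : List (Pid × Tr)}
      → All (λ c → Any (Match c) C₂) C₁ → All (λ c → Any (Match c) C₃) C₂
      → All (λ c → Any (Match c) C₃) C₁
    matches-trans []      B = []
    matches-trans (a ∷ A) B = match-trans a B ∷ matches-trans A B

    match-trans : {c : Pid × Tr} {C₂ C₃ : List (Pid × Tr)}
      → Any (Match c) C₂ → All (λ c → Any (Match c) C₃) C₂ → Any (Match c) C₃
    match-trans (here (e , s)) (b ∷ B) = Any.map (λ (e′ , s′) → trans e e′ , ⊑-trans s s′) b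
    match-trans (there a)      (_ ∷ B) = match-trans a B

  lift : {π : Pid} {X t R : Tr} → At π X t → t ⊑ R → ∃ λ Y → At π Y R × X ⊑ Y
  lift root s = _ , root , s
  lift (child mem at) (incl _ A) with find (All.lookup A mem)
  ... | _ , mem′ , (refl , s) with lift at s
  ...   | Y , at′ , X⊑Y = Y , child mem′ at′ , X⊑Y

  child-label : {M : Mk} {C : List (Pid × Tr)} {ℓ : Pid} {t : Tr}
    → IsPidTree (node M C) → (ℓ , t) ∈ C → ℓ ≢ []
  child-label (node labels _ _) mem = proj₁ (All.lookup labels mem)

  child-pidtree : {M : Mk} {C : List (Pid × Tr)} {ℓ : Pid} {t : Tr}
    → IsPidTree (node M C) → (ℓ , t) ∈ C → IsPidTree t
  child-pidtree (node _ _ subtrees) mem = All.lookup subtrees mem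

  at-pidtree : {π : Pid} {T R : Tr} → IsPidTree R → At π T R → IsPidTree T
  at-pidtree pt root           = pt
  at-pidtree pt (child mem at) = at-pidtree (child-pidtree pt mem) at

  labels-rigid : {C : List (Pid × Tr)} {ℓ z : Pid} {t₁ t₂ : Tr} → AllPairs (Apart L {nS}) (map proj₁ C)
    → (ℓ , t₁) ∈ C → (ℓ ++ z , t₂) ∈ C → ℓ ≢ [] → z ≡ [] × t₁ ≡ t₂
  labels-rigid (_ ∷ _) (here e₁) (here e₂) _ with ,-injective (trans e₁ (sym e₂))
  ... | ℓ≡ℓz , refl = ++-identityʳ-unique _ ℓ≡ℓz , refl
  labels-rigid (apart ∷ _) (here refl) (there m₂) ℓ≢[] =
    ⊥-elim (proj₁ (proj₂ (All.lookup apart (∈-map⁺ proj₁ m₂))) (∈subpid-++ _ _ ℓ≢[]))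
  labels-rigid (apart ∷ _) (there m₁) (here refl) ℓ≢[] =
    ⊥-elim (proj₂ (proj₂ (All.lookup apart (∈-map⁺ proj₁ m₁))) (∈subpid-++ _ _ ℓ≢[]))
  labels-rigid (_ ∷ apart) (there m₁) (there m₂) ℓ≢[] = labels-rigid apart m₁ m₂ ℓ≢[]

  descend : {σ τ ρ : Pid} {T Y R : Tr} → IsPidTree R → At σ T R → At τ Y R → τ ≡ σ ++ ρ → At ρ Y T
  descend pt root at₂ refl = at₂
  descend {ρ = ρ} pt (child {a = ℓ} {π = σ′} mem at) root eq =
    ⊥-elim (child-label pt mem (++-conicalˡ ℓ _ (sym (trans eq (++-assoc ℓ σ′ ρ)))))
  descend {ρ = ρ} pt@(node _ apart _) (child {a = ℓ} {π = σ′} mem at) (child {a = ℓ₂} {π = τ′} mem₂ at₂) eq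
    with ++-split ℓ₂ τ′ ℓ (σ′ ++ ρ) (trans eq (++-assoc ℓ σ′ ρ))
  ... | inj₁ (z , refl , e) with labels-rigid apart mem₂ mem (child-label pt mem₂)
  ...   | refl , refl = descend (child-pidtree pt mem) at at₂ e
  descend {ρ = ρ} pt@(node _ apart _) (child {a = ℓ} {π = σ′} mem at) (child {a = ℓ₂} {π = τ′} mem₂ at₂) eq
      | inj₂ (z , refl , e) with labels-rigid apart mem mem₂ (child-label pt mem)
  ...   | refl , refl = descend (child-pidtree pt mem) at at₂ (sym e)

  -- The empty position of a pid-tree is its root only (child labels are nonempty).
  root-position : {π : Pid} {Y T : Tr} → IsPidTree T → At π Y T → π ≡ [] → Y ≡ T
  root-position pt root                   _  = refl
  root-position pt (child {a = ℓ} mem _) eq = ⊥-elim (child-label pt mem (++-conicalˡ ℓ _ eq))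

  position-unique : {σ : Pid} {T T′ R : Tr} → IsPidTree R → At σ T R → At σ T′ R → T′ ≡ T
  position-unique {σ} pt at at′ =
    root-position (at-pidtree pt at) (descend pt at at′ (sym (++-identityʳ σ))) refl

  child-position : {π : Pid} {a : ℕ} {M : Mk} {C : List (Pid × Tr)} {Y : Tr}
    → IsPidTree (node M C) → At π Y (node M C) → π ≡ a ∷ [] → ((a ∷ []) , Y) ∈ C
  child-position pt root ()
  child-position pt (child {a = []} mem _) _ = ⊥-elim (child-label pt mem refl)
  child-position pt (child {a = b ∷ ℓ} {π = π} mem at) eq with ∷-injective eq
  ... | refl , e with ++-conicalˡ ℓ π e | ++-conicalʳ ℓ π e
  ...   | refl | refl with root-position (child-pidtree pt mem) at refl
  ...     | refl = mem

  -- path π m: the single branch π, with one component per edge, decorated by m at its end.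
  path : Pid → Mk → Tr
  path []      m = node m []
  path (a ∷ π) m = node [] ((a ∷ [] , path π m) ∷ [])

  path-pidtree : {π : Pid} (m : Mk) → All NonZero π → IsPidTree (path π m)
  path-pidtree m []          = node [] [] []
  path-pidtree m (a>0 ∷ π>0) = node (((λ ()) , a>0 ∷ []) ∷ []) ([] ∷ []) (path-pidtree m π>0 ∷ [])

  path-end : (π : Pid) (m : Mk) → At π (node m []) (path π m)
  path-end []      m = root
  path-end (a ∷ π) m = child (here refl) (path-end π m)

  path-position : {π π′ : Pid} {m : Mk} {t′ : Tr}
    → At π′ t′ (path π m) → ∃ λ z → π ≡ π′ ++ z × t′ ≡ path z m
  path-position {[]}    root                   = [] , refl , refl
  path-position {a ∷ π} root                   = a ∷ π , refl , refl
  path-position {[]}    (child () _)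
  path-position {a ∷ π} (child (there ()) _)
  path-position {a ∷ π} (child (here refl) at) with path-position at
  ... | z , refl , refl = z , refl , refl

  path-is-path : {π : Pid} (m : Mk) → All NonZero π → IsPath L π m (path π m)
  path-is-path {π} m π>0 = path-pidtree m π>0 , (_ , path-end π m) , on-branch , path-end π m , empty-elsewhere
    where
      on-branch : (π′ : Pid) → _∈pid_ L π′ (path π m) → (π′ ∈subpid π) ⊎ (π′ ≡ [])
      on-branch []       _        = inj₂ refl
      on-branch (b ∷ π′) (_ , at) with path-position at
      ... | z , refl , _ = inj₁ (∈subpid-++ (b ∷ π′) z (λ ()))

      empty-elsewhere : (π′ : Pid) (t′ : Tr) → At π′ t′ (path π m) → π′ ≢ π → markingOf L t′ ≡ []
      empty-elsewhere π′ t′ at π′≢π with path-position at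
      ... | []    , π≡ , _    = ⊥-elim (π′≢π (sym (trans π≡ (++-identityʳ π′))))
      ... | _ ∷ _ , _  , refl = refl

module _ (L : Lang) where

  seqM-∷ : {A : Set} (x : Maybe A) (xs : List (Maybe A)) {ys : List A} → seqM L (x ∷ xs) ≡ just ys
    → ∃ λ a → ∃ λ as → x ≡ just a × seqM L xs ≡ just as × ys ≡ a ∷ as
  seqM-∷ (just a) xs eq with seqM L xs
  seqM-∷ (just a) xs refl | just as = a , as , refl , refl , refl
  seqM-∷ (just a) xs ()   | nothing
  seqM-∷ nothing  xs ()

  seqM-All : {A : Set} {P : A → Set} {xs : List (Maybe A)} {ys : List A}
    → seqM L xs ≡ just ys → All (_⇒ P) xs → All P ys
  seqM-All {xs = []}     refl []       = []
  seqM-All {xs = x ∷ xs} eq   (h ∷ hs) with seqM-∷ x xs eq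
  ... | a , as , x≡a , eqs , refl = h x≡a ∷ seqM-All eqs hs

  seqM-∈ : {A : Set} {xs : List (Maybe A)} {ys : List A} {x : Maybe A}
    → seqM L xs ≡ just ys → x ∈ xs → ∃ λ y → x ≡ just y × y ∈ ys
  seqM-∈ {xs = x ∷ xs} eq x∈ with seqM-∷ x xs eq | x∈
  ... | a , as , refl , _   , refl | here refl  = a , refl , here refl
  ... | a , as , _    , eqs , refl | there x∈xs with seqM-∈ eqs x∈xs
  ...   | y , x≡y , y∈as = y , x≡y , there y∈as

-- Soundness of reachable markings: tokens are well typed and all their pids are positive

module SoundTokens (L : Lang) (N : TNet L) where
  open TNet N using (nS; nT) renaming (trans to transition)

  Positive : Val L → Set
  Positive (pidv π) = All NonZero π
  Positive (datv _) = ⊤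

  PositiveToken : Place nS × List (Val L) → Set
  PositiveToken (_ , v) = All Positive v

  SoundToken : Place nS × List (Val L) → Set
  SoundToken (s , v) = Typed L N s v × All Positive v

  Sound : Marking L nS → Set
  Sound = All SoundToken

  initial-sound : WellFormedNet L N → Sound (M₀ L N)
  initial-sound wf = ((1 ∷ [] , 0 , refl) , (_ ∷ []) ∷ tt ∷ [])
                   ∷ AllP.map⁺ (All.map (λ typed → typed , data-positive _) wf)
    where
      data-positive : (ds : List (Dat L)) → All Positive (map datv ds)
      data-positive []       = []
      data-positive (_ ∷ ds) = tt ∷ data-positive ds

  module Firing (t : Fin nT) (β : Binding L) {pre : Marking L nS}
                (pre≡ : preM L (transition t) β ≡ just pre) (sound-pre : Sound pre) where
    open Transition (transition t)

    generator-head-positive : (a b : Maybe (Val L)) {v : Val L} {y : Place nS × List (Val L)} → a ≡ just v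
      → (seqM L (a ∷ b ∷ []) >>= λ w → just (sη , w)) ≡ just y → SoundToken y → Positive v
    generator-head-positive (just v) (just c) refl refl (_ , v>0 ∷ _) = v>0
    generator-head-positive (just v) nothing  refl ()

    -- Each pid variable p_i is bound to a pid of a consumed generator token, hence positive.
    bound-pid-positive : (i : Fin k) → β (pv i) ⇒ Positive
    bound-pid-positive i e with seqM-∈ L pre≡ (∈-++⁺ˡ (∈-map⁺ _ (∈-allFin i)))
    ... | y , gen≡y , y∈pre = generator-head-positive (β (pv i)) (β (cv i)) e gen≡y (All.lookup sound-pre y∈pre)

    asPid-just : (a : Maybe (Val L)) {π : Pid} → asPid L a ≡ just π → a ≡ just (pidv π)
    asPid-just (just (pidv π)) refl = refl
    asPid-just (just (datv _)) ()
    asPid-just nothing         ()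

    -- A fresh pid p_i.(c_i + j + 1) extends a positive pid by a positive component.
    child-pid-positive : (i : Fin k) (j : ℕ) → childPid L (transition t) β i (suc j) ⇒ Positive
    child-pid-positive i j =
      >>=-⇒ (asPid L (β (pv i))) {P = Positive} λ π≡ → >>=-⇒ (asNat L (β (cv i))) {P = Positive} λ {c} _ →
        λ { refl → AllP.∷ʳ⁺ (bound-pid-positive i (asPid-just _ π≡)) (≢-nonZero (m+1+n≢0 c)) }

    output-positive : (e : OutE L k m n) → evalOut1 L (transition t) β e ⇒ Positive
    output-positive (oData d)    = >>=-⇒ (Lang.evalE L d (datOnly L β)) {P = Positive} λ _ → λ { refl → tt }
    output-positive (oChild i j) = child-pid-positive i (toℕ j)
    output-positive (oParent i)  = bound-pid-positive _

    -- The three groups of produced tokens: updated generators, new generators, ordinary outputs.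
    post-positive : {post : Marking L nS} → postM L (transition t) β ≡ just post → All PositiveToken post
    post-positive post≡ = seqM-All L post≡
      (AllP.++⁺ (AllP.map⁺ (All.universal carried (allFin m)))
      (AllP.++⁺ (AllP.concat⁺ (AllP.map⁺ (All.universal
                  (λ i → AllP.map⁺ (All.universal (spawned i) (allFin (n i)))) (allFin k))))
                (AllP.concat⁺ (AllP.map⁺ (All.universal
                  (λ s → AllP.map⁺ (All.universal (produced s) (outArc s))) (allFin nS))))))
      where
        carried : (i : Fin m) → (β (pv (inject≤ i m≤k)) >>= λ p → asNat L (β (cv (inject≤ i m≤k))) >>= λ c →
                                   just (sη , (p ∷ num L (c + n (inject≤ i m≤k)) ∷ []))) ⇒ PositiveToken
        carried i = >>=-⇒ (β (pv (inject≤ i m≤k))) {P = PositiveToken} λ e →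
                    >>=-⇒ (asNat L (β (cv (inject≤ i m≤k)))) {P = PositiveToken} λ _ →
                    λ { refl → bound-pid-positive _ e ∷ tt ∷ [] }

        spawned : (i : Fin k) (j : Fin (n i)) → (childPid L (transition t) β i (suc (toℕ j)) >>= λ p →
                                                  just (sη , (p ∷ num L 0 ∷ []))) ⇒ PositiveToken
        spawned i j = >>=-⇒ (childPid L (transition t) β i (suc (toℕ j))) {P = PositiveToken} λ e →
                      λ { refl → child-pid-positive i (toℕ j) e ∷ tt ∷ [] }

        produced : (s : Fin nS) (vec : List (OutE L k m n)) → (seqM L (map (evalOut1 L (transition t) β) vec) >>= λ v →
                                                                just (pl s , v)) ⇒ PositiveToken
        produced s vec = >>=-⇒ (seqM L (map (evalOut1 L (transition t) β) vec)) {P = PositiveToken} λ e →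
                         λ { refl → seqM-All L e (AllP.map⁺ (All.universal output-positive vec)) }

  step-sound : {M M′ : Marking L nS} → Sound M → Step L N M M′ → Sound M′
  step-sound sound (t , β , pre , post , pre≡ , post≡ , typed , _ , R , M↭pre++R , M′↭R++post)
    with AllP.++⁻ pre (All-resp-↭ M↭pre++R sound)
  ... | sound-pre , sound-R = All-resp-↭ (↭-sym M′↭R++post)
        (AllP.++⁺ sound-R (All.zip (typed , Firing.post-positive t β pre≡ sound-pre post≡)))

  reachable-sound : WellFormedNet L N → {M : Marking L nS} → Reachable L N M → Sound M
  reachable-sound wf = preserved (initial-sound wf)
    where
      preserved : {A B : Marking L nS} → Sound A → Star (Step L N) A B → Sound B
      preserved sound ε              = sound
      preserved sound (step ◅ steps) = preserved (step-sound sound step) steps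

module TokenRequirements (L : Lang) (N : TNet L) where
  open TNet N using (nS; ty)
  open SoundTokens L N

  pidReqs-source : {r : Pid × Marking L nS} (tys : List Ty) (v : List (Val L))
    → r ∈ pidReqs L N tys v → pidv (proj₁ r) ∈ v
  pidReqs-source (ℙty ∷ tys) (pidv x ∷ v) (here refl) = here refl
  pidReqs-source (ℙty ∷ tys) (pidv x ∷ v) (there r∈) = there (pidReqs-source tys v r∈)
  pidReqs-source (ℙty ∷ tys) (datv d ∷ v) r∈         = there (pidReqs-source tys v r∈)
  pidReqs-source (𝔻ty ∷ tys) (_      ∷ v) r∈         = there (pidReqs-source tys v r∈)

  pidReqs-complete : {ρ : Pid} {tys : List Ty} {v : List (Val L)}
    → Pointwise (HasTy L) tys v → pidv ρ ∈ v → (ρ , []) ∈ pidReqs L N tys v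
  pidReqs-complete {tys = ℙty ∷ _} ((π , refl) ∷ _)  (here refl) = here refl
  pidReqs-complete {tys = ℙty ∷ _} ((π , refl) ∷ pw) (there ρ∈) = there (pidReqs-complete pw ρ∈)
  pidReqs-complete {tys = 𝔻ty ∷ _} ((d , refl) ∷ pw) (there ρ∈) = pidReqs-complete pw ρ∈

  ownerReq-source : {r : Pid × Marking L nS} (s : Place nS) (v : List (Val L))
    → r ∈ ownerReq L N s v → pidv (proj₁ r) ∈ v
  ownerReq-source s (pidv x ∷ v) (here refl) = here refl

  token-requirement-source : {s : Place nS} {v : List (Val L)} {r : Pid × Marking L nS}
    → SoundToken (s , v) → r ∈ reqTok L N s v
    → (proj₁ r ≡ []) ⊎ (pidv (proj₁ r) ∈ v)
      ⊎ ∃ λ π → ∃ λ i → (s , v) ≡ (sη , pidv π ∷ num L i ∷ []) × proj₁ r ≡ π ∷ʳ suc i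
  token-requirement-source {sη} ((π , i , refl) , _) (here refl)         = inj₂ (inj₁ (here refl))
  token-requirement-source {sη} ((π , i , refl) , _) (there (here refl)) = inj₂ (inj₂ (π , i , refl , refl))
  token-requirement-source {pl s} {v} _ r∈ with List⁺.head (ty s)
  token-requirement-source {pl s} {v} _ (here refl) | 𝔻ty = inj₁ refl
  token-requirement-source {pl s} {v} _ (there r∈)  | 𝔻ty =
    inj₂ (inj₁ (pidReqs-source (List⁺.toList (ty s)) v r∈))
  token-requirement-source {pl s} {v} _ r∈          | ℙty with ∈-++⁻ (ownerReq L N (pl s) v) r∈
  ... | inj₁ r∈owner = inj₂ (inj₁ (ownerReq-source (pl s) v r∈owner))
  ... | inj₂ r∈pids  = inj₂ (inj₁ (pidReqs-source (List⁺.toList (ty s)) v r∈pids))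

  token-pid-required : {s : Place nS} {v : List (Val L)} {ρ : Pid}
    → SoundToken (s , v) → pidv ρ ∈ v → (ρ , []) ∈ reqTok L N s v
  token-pid-required {sη} ((π , i , refl) , _) (here refl)         = here refl
  token-pid-required {sη} ((π , i , refl) , _) (there (here ()))
  token-pid-required {pl s} {v} (typed , _) ρ∈ with pidReqs-complete typed ρ∈ | List⁺.head (ty s)
  ... | ρ∈pids | 𝔻ty = there ρ∈pids
  ... | ρ∈pids | ℙty = ∈-++⁺ʳ (ownerReq L N (pl s) v) ρ∈pids

-- The canonical representation of a sound clean marking

module Canonical (L : Lang) (N : TNet L) {M : Marking L (TNet.nS N)}
                 (sound : SoundTokens.Sound L N M) (clean : Clean L M) where
  open TNet N using (nS)
  open Trees L nS
  open TokenRequirements L N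

  requirements : List (Pid × Mk)
  requirements = reqs L N M

  token-reqs : Place nS × List (Val L) → List (Pid × Mk)
  token-reqs (s , v) = reqTok L N s v

  Required : Pid → Set
  Required π = π ∈ map proj₁ requirements

  demand : Pid → Mk
  demand π = gather L N π requirements

  demand-absent : {π : Pid} → ¬ Required π → demand π ≡ []
  demand-absent = absent requirements
    where
      absent : {π : Pid} (rs : List (Pid × Mk)) → ¬ (π ∈ map proj₁ rs) → gather L N π rs ≡ []
      absent [] _ = refl
      absent {π} (r ∷ rs) π∉ with proj₁ r ≟ₚ π
      ... | yes r≡π = ⊥-elim (π∉ (here (sym r≡π)))
      ... | no  _   = absent rs (λ π∈ → π∉ (there π∈))

  required-source : {ρ : Pid} → Required ρ → (ρ ≡ []) ⊎ ActivePid L ρ M ⊎ NextPid L ρ M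
  required-source req with ∈-map⁻ proj₁ req
  ... | r , r∈rs , refl with find (∈-concatMap⁻ token-reqs r∈rs)
  ... | (s , v) , sv∈M , r∈tok with token-requirement-source (All.lookup sound sv∈M) r∈tok
  ...   | inj₁ ρ≡[]                       = inj₁ ρ≡[]
  ...   | inj₂ (inj₁ ρ∈v)                 = inj₂ (inj₁ (lose sv∈M ρ∈v))
  ...   | inj₂ (inj₂ (π , i , refl , ρ≡)) = inj₂ (inj₂ (π , i , sv∈M , ρ≡))

  active-required : {ρ : Pid} → ActivePid L ρ M → Required ρ
  active-required active with find active
  ... | (s , v) , sv∈M , ρ∈v =
    ∈-map⁺ proj₁ (∈-concatMap⁺ token-reqs (lose sv∈M (token-pid-required (All.lookup sound sv∈M) ρ∈v)))

  active-positive : {ρ : Pid} → ActivePid L ρ M → All NonZero ρ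
  active-positive active with find active
  ... | _ , sv∈M , ρ∈v = All.lookup (proj₂ (All.lookup sound sv∈M)) ρ∈v

  required-positive : {ρ : Pid} → Required ρ → All NonZero ρ
  required-positive req with required-source req
  ... | inj₁ refl                    = []
  ... | inj₂ (inj₁ active)           = active-positive active
  ... | inj₂ (inj₂ (π , i , gen∈M , refl)) with All.lookup sound gen∈M
  ...   | _ , π>0 ∷ _ = AllP.∷ʳ⁺ π>0 _

  -- Cleanliness: the parent of a required pid (other than ⟨1⟩) is active, hence required.
  required-parent : {x : Pid} {c : ℕ} → Required (x ∷ʳ c) → x ≢ [] → Required x
  required-parent {x} {c} req x≢[] with required-source req
  ... | inj₁ x∷ʳc≡[] = ⊥-elim (∷ʳ-nonempty x c x∷ʳc≡[])
  ... | inj₂ active-or-next =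
    active-required (subst (λ π → ActivePid L π M) (prefix-∷ʳ x c)
                           (clean (x ∷ʳ c) active-or-next (not-initial x x≢[])))
    where
      not-initial : (y : Pid) → y ≢ [] → y ∷ʳ c ≢ 1 ∷ []
      not-initial []      y≢[] _  = y≢[] refl
      not-initial (_ ∷ y) _    eq = ∷ʳ-nonempty y c (proj₂ (∷-injective eq))

  required-prefix : (x ys : Pid) → Required (x ++ ys) → x ≢ [] → Required x
  required-prefix x []       req x≢[] = subst Required (++-identityʳ x) req
  required-prefix x (c ∷ ys) req x≢[] =
    required-parent (required-prefix (x ∷ʳ c) ys (subst Required (sym (++-assoc x (c ∷ []) ys)) req)
                                     (∷ʳ-nonempty x c)) x≢[]

  -- A bound on the lengths and components of all required pids; it bounds the canonical tree.
  size : Pid → ℕ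
  size ρ = length ρ + sum ρ

  bound : ℕ
  bound = suc (sum (map size (map proj₁ requirements)))

  required-length : {ρ : Pid} → Required ρ → length ρ ≤ bound
  required-length {ρ} req =
    ≤-trans (m≤m+n (length ρ) (sum ρ)) (≤-trans (∈⇒≤sum (∈-map⁺ size req)) (n≤1+n _))

  required-component : {ρ : Pid} {a : ℕ} → Required ρ → a ∈ ρ → a < bound
  required-component {ρ} req a∈ρ =
    s≤s (≤-trans (∈⇒≤sum a∈ρ) (≤-trans (m≤n+m (sum ρ) (length ρ)) (∈⇒≤sum (∈-map⁺ size req))))

  candidates : Pid → List ℕ
  candidates σ = filter (λ a → σ ∷ʳ a ∈? map proj₁ requirements) (upTo bound)

  candidates-required : (σ : Pid) → All (λ a → Required (σ ∷ʳ a)) (candidates σ)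
  candidates-required σ = AllP.all-filter (λ a → σ ∷ʳ a ∈? map proj₁ requirements) (upTo bound)

  candidates-increasing : (σ : Pid) → AllPairs _<_ (candidates σ)
  candidates-increasing σ = AllPairsP.filter⁺ (λ a → σ ∷ʳ a ∈? map proj₁ requirements)
                              (AllPairsP.applyUpTo⁺₁ (λ a → a) bound (λ a<b _ → a<b))

  canonical : ℕ → Pid → Tr
  canonical zero    σ = node (demand σ) []
  canonical (suc d) σ = node (demand σ) (map (λ a → a ∷ [] , canonical d (σ ∷ʳ a)) (candidates σ))

  R₀ : Tr
  R₀ = canonical bound []

  singletons-apart : {a b : ℕ} → a < b → Apart L {nS} (a ∷ []) (b ∷ [])
  singletons-apart a<b = (λ eq → <-irrefl (proj₁ (∷-injective eq)) a<b)
                       , (λ a∈b → <-irrefl (proj₁ (∷-injective (∈subpid-singleton a∈b))) a<b)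
                       , (λ b∈a → <-irrefl (sym (proj₁ (∷-injective (∈subpid-singleton b∈a)))) a<b)

  canonical-pidtree : (d : ℕ) (σ : Pid) → IsPidTree (canonical d σ)
  canonical-pidtree zero    σ = node [] [] []
  canonical-pidtree (suc d) σ =
    node (AllP.map⁺ (All.map (λ req → (λ ()) , proj₂ (AllP.∷ʳ⁻ (required-positive req)) ∷ [])
                             (candidates-required σ)))
         (AllPairsP.map⁺ (AllPairsP.map⁺ (AllPairs.map singletons-apart (candidates-increasing σ))))
         (AllP.map⁺ (All.universal (λ a → canonical-pidtree d (σ ∷ʳ a)) (candidates σ)))

  canonical-sorted : (d : ℕ) (σ : Pid) → SiblingOrdered L (canonical d σ)
  canonical-sorted zero    σ = node [] []
  canonical-sorted (suc d) σ =
    node (AllPairs⇒Linked (AllPairsP.map⁺ (AllPairsP.map⁺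
           (AllPairs.map (λ a<b → inj₂ (refl , <∷ a<b)) (candidates-increasing σ)))))
         (AllP.map⁺ (All.universal (λ a → canonical-sorted d (σ ∷ʳ a)) (candidates σ)))

  -- Seen from σ, the path to a required pid σ.ρ lies in the canonical tree below σ
  -- (this is where prefix-closure of the requirements is needed).
  path-included : (d : ℕ) (σ ρ τ : Pid) → τ ≡ σ ++ ρ → Required τ → length ρ ≤ d
    → path ρ (demand τ) ⊑ canonical d σ
  path-included zero    σ [] τ refl _ _ rewrite ++-identityʳ σ = incl (≤M-refl _) []
  path-included (suc d) σ [] τ refl _ _ rewrite ++-identityʳ σ = incl (≤M-refl _) []
  path-included (suc d) σ (a ∷ ρ) τ τ≡ req (s≤s |ρ|≤d) =
    incl ([]≤M _) (lose (∈-map⁺ (λ a → a ∷ [] , canonical d (σ ∷ʳ a)) a∈candidates)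
                        (refl , path-included d (σ ∷ʳ a) ρ τ τ≡′ req |ρ|≤d) ∷ [])
    where
      τ≡′ : τ ≡ (σ ∷ʳ a) ++ ρ
      τ≡′ = trans τ≡ (sym (++-assoc σ (a ∷ []) ρ))
      a∈candidates : a ∈ candidates σ
      a∈candidates = ∈-filter⁺ (λ a → σ ∷ʳ a ∈? map proj₁ requirements)
        (∈-upTo⁺ (required-component req (subst (a ∈_) (sym τ≡) (∈-++⁺ʳ σ (here refl)))))
        (required-prefix (σ ∷ʳ a) ρ (subst Required τ≡′ req) (∷ʳ-nonempty σ a))

  canonical-satisfies : SatisfiesRules L N M R₀
  canonical-satisfies π req = path π (demand π) , path-is-path (demand π) (required-positive req)
                            , path-included bound [] π π refl req (required-length req)

  module Least {R : Tr} (pt : IsPidTree R) (sat : SatisfiesRules L N M R) where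

    -- The node of R at σ carries at least the demand at σ: the path required for σ ends there.
    demand-below : {σ : Pid} {MT : Mk} {CT : List (Pid × Tr)} → At σ (node MT CT) R → demand σ ≤M MT
    demand-below {σ} at with σ ∈? map proj₁ requirements
    ... | no ¬req rewrite demand-absent ¬req = []≤M _
    ... | yes req with sat σ req
    ...   | t , (_ , _ , _ , at-end , _) , t⊑R with lift at-end t⊑R
    ...     | node MY CY , at′ , incl demand≤MY _ with position-unique pt at at′
    ...       | refl = demand≤MY

    -- Each required child σ.a of σ is a child of the node of R at σ, by rigidity of R.
    canonical-below : (d : ℕ) (σ : Pid) {T : Tr} → At σ T R → canonical d σ ⊑ T
    canonical-below zero    σ {node MT CT} at = incl (demand-below at) []
    canonical-below (suc d) σ {node MT CT} at =
      incl (demand-below at) (AllP.map⁺ (All.map child-below (candidates-required σ)))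
      where
        child-below : {a : ℕ} → Required (σ ∷ʳ a) → Any (Match (a ∷ [] , canonical d (σ ∷ʳ a))) CT
        child-below {a} req with sat (σ ∷ʳ a) req
        ... | t , (_ , _ , _ , at-end , _) , t⊑R with lift at-end t⊑R
        ...   | Y , at-Y , _ = lose (child-position (at-pidtree pt at) (descend pt at at-Y refl) refl)
                                    (refl , canonical-below d (σ ∷ʳ a) at-Y)

  canonical-least : {R : Tr} → IsPidTree R → SatisfiesRules L N M R → R₀ ⊑ R
  canonical-least pt sat = Least.canonical-below pt sat bound [] root

  canonical-in-repr : InRepr L N M R₀
  canonical-in-repr = canonical-pidtree bound [] , canonical-sorted bound [] , canonical-satisfies
                    , λ R pt _ sat _ → canonical-least pt sat

  repr-equivalent : {R : Tr} → InRepr L N M R → R ⊑ R₀ × R₀ ⊑ R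
  repr-equivalent (pt , _ , sat , minimal) =
    minimal R₀ (canonical-pidtree bound []) (canonical-sorted bound []) canonical-satisfies (canonical-least pt sat)
    , canonical-least pt sat

proposition6 : (L : Lang) (N : TNet L) → WellFormedNet L N
    → (M : Marking L (TNet.nS N)) → Reachable L N M → Clean L M
    → UniqueRepr L N M
proposition6 L N wf M reach clean = (R₀ , canonical-in-repr) , unique
  where
    open Canonical L N (SoundTokens.reachable-sound L N wf reach) clean
    open Trees L (TNet.nS N) using (_⊑_; ⊑-trans)

    unique : (R₁ R₂ : Tree L) → InRepr L N M R₁ → InRepr L N M R₂ → R₁ ⊑ R₂ × R₂ ⊑ R₁
    unique R₁ R₂ in₁ in₂ with repr-equivalent in₁ | repr-equivalent in₂
    ... | R₁⊑R₀ , R₀⊑R₁ | R₂⊑R₀ , R₀⊑R₂ = ⊑-trans R₁⊑R₀ R₀⊑R₂ , ⊑-trans R₂⊑R₀ R₀⊑R₁
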